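{- Suppose $Act$ is finite. Then the axiom system $\mathcal{E}_\omega=\mathcal{E}_v\cup\{Y_\omega,N_\omega\}$, where $(Y_\omega)$ is $\mathit{yes}=\sum_{a\in Act}a.\mathit{yes}$ and $(N_\omega)$ is $\mathit{no}=\sum_{a\in Act}a.\mathit{no}$, is ground complete for $\omega$-verdict equivalence: for all closed $m,n\in Mon_F$, if $m\simeq_\omega n$ then $\mathcal{E}_\omega\vdash m=n$.
   Context: Fix a set $Act$ of visible actions, a symbol $\tau\notin Act$, and a countably infinite set $Var$ of variables disjoint from $Act\cup\{\tau\}$. The set $Mon_F$ of monitors is generated by $m,n ::= v \mid a.m \mid m+n \mid x$ with $a\in Act$, $x\in Var$, and verdicts $v ::= \mathit{end}\mid \mathit{yes}\mid \mathit{no}$. A monitor is closed if it contains no variables; a (closed) substitution $\sigma$ maps variables to (closed) monitors. For a finite index set $I$, $\sum_{i\in I}m_i$ denotes $\mathit{end}$ if $I=\emptyset$ and $m_{i_1}+\cdots+m_{i_k}$ otherwise. Transitions: for $\alpha\in Act\cup\{\tau\}$, $\xrightarrow{\alpha}$ is the least relation with $a.m\xrightarrow{a}m$; if $m\xrightarrow{\alpha}m'$ then $m+n\xrightarrow{\alpha}m'$ and $n+m\xrightarrow{\alpha}m'$; and $v\xrightarrow{\alpha}v$ for every verdict $v$ and every $\alpha$. Weak transitions: $m\xRightarrow{\varepsilon}m'$ iff $m(\xrightarrow{\tau})^*m'$; $m\xRightarrow{a}m'$ iff $m\xRightarrow{\varepsilon}m_1\xrightarrow{a}m_2\xRightarrow{\varepsilon}m'$;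 $m\xRightarrow{as'}m'$ ($s'\neq\varepsilon$) iff $m\xRightarrow{a}m_1\xRightarrow{s'}m'$. Let $L_a(m)=\{s\in Act^*\mid m\xRightarrow{s}\mathit{yes}\}$, $L_r(m)=\{s\in Act^*\mid m\xRightarrow{s}\mathit{no}\}$. For closed $m,n$: $m\simeq_\omega n$ iff $L_a(m)\cdot Act^\omega=L_a(n)\cdot Act^\omega$ and $L_r(m)\cdot Act^\omega=L_r(n)\cdot Act^\omega$ ($Act^\omega$ = infinite sequences over $Act$, $\cdot$ = concatenation). $\mathcal{E}\vdash m=n$ means derivability by equational logic: reflexivity, symmetry, transitivity, substitutivity (from $t=t'$ infer $\sigma(t)=\sigma(t')$) and congruence for $a.\_$ and $+$. $\mathcal{E}_v$ consists of: (A1) $x+y=y+x$; (A2) $x+(y+z)=(x+y)+z$; (A3) $x+x=x$; (A4) $x+\mathit{end}=x$; and for each $a\in Act$: $(E_a)$ $a.\mathit{end}=\mathit{end}$; $(Y_a)$ $\mathit{yes}=\mathit{yes}+a.\mathit{yes}$; $(N_a)$ $\mathit{no}=\mathit{no}+a.\mathit{no}$; $(D_a)$ $a.(x+y)=a.x+a.y$. -}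

module Defs where

open import Data.Nat using (ℕ)
open import Data.Fin using (Fin)
open import Data.List using (List; []; _∷_; map; allFin)
open import Data.Product using (Σ; ∃; _×_; _,_)
open import Data.Sum using (_⊎_)
open import Data.Unit using (⊤; tt)
open import Function.Bundles using (_⇔_)
open import Relation.Binary.Construct.Closure.ReflexiveTransitive using (Star)

-- Act is a finite set with n elements, represented as Fin n.
-- Var is the countably infinite set ℕ.
Var : Set
Var = ℕ

data Verdict : Set where
  end yes no : Verdict

data Mon (n : ℕ) : Set where
  verd : Verdict → Mon n
  _∙_  : Fin n → Mon n → Mon n
  _⊕_  : Mon n → Mon n → Mon n
  var  : Var → Mon n

infixr 7 _∙_
infixl 6 _⊕_

data Closed {n : ℕ} : Mon n → Set where
  c-verd : ∀ v → Closed (verd v)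
  c-pre  : ∀ a {m} → Closed m → Closed (a ∙ m)
  c-sum  : ∀ {m m'} → Closed m → Closed m' → Closed (m ⊕ m')

Label : ℕ → Set
Label n = Fin n ⊎ ⊤

τ : ∀ {n} → Label n
τ = _⊎_.inj₂ tt

act : ∀ {n} → Fin n → Label n
act = _⊎_.inj₁

data Step {n : ℕ} : Mon n → Label n → Mon n → Set where
  pre  : ∀ a m → Step (a ∙ m) (act a) m
  sumL : ∀ {m m' α} k → Step m α m' → Step (m ⊕ k) α m'
  sumR : ∀ {m m' α} k → Step m α m' → Step (k ⊕ m) α m'
  verdS : ∀ v α → Step (verd v) α (verd v)

WeakEps : ∀ {n} → Mon n → Mon n → Set
WeakEps = Star (λ m m' → Step m τ m')

WeakAct : ∀ {n} → Mon n → Fin n → Mon n → Set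
WeakAct m a m' = ∃ λ m₁ → ∃ λ m₂ → WeakEps m m₁ × Step m₁ (act a) m₂ × WeakEps m₂ m'

Weak : ∀ {n} → Mon n → List (Fin n) → Mon n → Set
Weak m [] m' = WeakEps m m'
Weak m (a ∷ []) m' = WeakAct m a m'
Weak m (a ∷ b ∷ s) m' = ∃ λ m₁ → WeakAct m a m₁ × Weak m₁ (b ∷ s) m'

La : ∀ {n} → Mon n → List (Fin n) → Set
La m s = Weak m s (verd yes)

Lr : ∀ {n} → Mon n → List (Fin n) → Set
Lr m s = Weak m s (verd no)

Stream : ℕ → Set
Stream n = ℕ → Fin n

data Prefix {n : ℕ} : List (Fin n) → Stream n → Set where
  p-nil  : ∀ w → Prefix [] w
  p-cons : ∀ {s w} → Prefix s (λ i → w (ℕ.suc i)) → Prefix (w ℕ.zero ∷ s) w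

Ext : ∀ {n} → (List (Fin n) → Set) → Stream n → Set
Ext L w = ∃ λ s → L s × Prefix s w

_≃ω_ : ∀ {n} → Mon n → Mon n → Set
m ≃ω m' = (∀ w → Ext (La m) w ⇔ Ext (La m') w) × (∀ w → Ext (Lr m) w ⇔ Ext (Lr m') w)

sumL' : ∀ {n} → List (Mon n) → Mon n
sumL' [] = verd end
sumL' (m ∷ []) = m
sumL' (m ∷ m' ∷ ms) = m ⊕ sumL' (m' ∷ ms)

sumAct : ∀ {n} → Mon n → Mon n
sumAct {n} t = sumL' (map (λ a → a ∙ t) (allFin n))

x y z : ∀ {n} → Mon n
x = var 0
y = var 1
z = var 2

data Eω {n : ℕ} : Mon n → Mon n → Set where
  A1 : Eω (x ⊕ y) (y ⊕ x)
  A2 : Eω (x ⊕ (y ⊕ z)) ((x ⊕ y) ⊕ z)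
  A3 : Eω (x ⊕ x) x
  A4 : Eω (x ⊕ verd end) x
  Ea : ∀ a → Eω (a ∙ verd end) (verd end)
  Ya : ∀ a → Eω (verd yes) (verd yes ⊕ a ∙ verd yes)
  Na : ∀ a → Eω (verd no) (verd no ⊕ a ∙ verd no)
  Da : ∀ a → Eω (a ∙ (x ⊕ y)) (a ∙ x ⊕ a ∙ y)
  Yω : Eω (verd yes) (sumAct (verd yes))
  Nω : Eω (verd no) (sumAct (verd no))

_[_] : ∀ {n} → Mon n → (Var → Mon n) → Mon n
verd v [ σ ] = verd v
(a ∙ m) [ σ ] = a ∙ (m [ σ ])
(m ⊕ m') [ σ ] = (m [ σ ]) ⊕ (m' [ σ ])
var v [ σ ] = σ v

data _⊢_≈_ {n : ℕ} (E : Mon n → Mon n → Set) : Mon n → Mon n → Set where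
  ax    : ∀ {t t'} → E t t' → E ⊢ t ≈ t'
  refl  : ∀ {t} → E ⊢ t ≈ t
  sym   : ∀ {t t'} → E ⊢ t ≈ t' → E ⊢ t' ≈ t
  trans : ∀ {t t' t''} → E ⊢ t ≈ t' → E ⊢ t' ≈ t'' → E ⊢ t ≈ t''
  subst : ∀ {t t'} (σ : Var → Mon n) → E ⊢ t ≈ t' → E ⊢ (t [ σ ]) ≈ (t' [ σ ])
  cong∙ : ∀ a {t t'} → E ⊢ t ≈ t' → E ⊢ (a ∙ t) ≈ (a ∙ t')
  cong⊕ : ∀ {t t' u u'} → E ⊢ t ≈ t' → E ⊢ u ≈ u' → E ⊢ (t ⊕ u) ≈ (t' ⊕ u')

-- Let ∂ₐ m be the syntactic derivative of m by the action a (a.m ↦ m,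
-- b.m ↦ end for b ≠ a, verdicts fixed, ∂ₐ distributing over +). The axioms prove
-- the expansion law m = Σₐ a.∂ₐ m for closed m (Yω and Nω handle the verdicts
-- yes and no, Eₐ the verdict end). On the semantic side, m reaches a conclusive
-- verdict along s exactly when that verdict is a summand of the iterated
-- derivative ∂ₛ m, so ω-verdict equivalence passes to derivatives. Induction on
-- the prefix depth therefore reduces completeness to monitors without prefixes,
-- that is sums of verdicts, which are determined up to A1-A4 by the conclusive
-- verdicts among their summands.
module Submission where

open import Defs
open import Algebra.Bundles using (IdempotentCommutativeMonoid)
import Algebra.Properties.CommutativeSemigroup as CommutativeSemigroupProperties
open import Data.Empty using (⊥)
open import Data.Fin using (Fin; zero; _≟_)
open import Data.List using (List; []; _∷_; map; foldr; allFin)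
open import Data.List.Membership.Propositional using (_∈_)
open import Data.List.Membership.Propositional.Properties using (∈-allFin)
open import Data.List.Relation.Unary.Any using (here; there)
open import Data.Nat using (ℕ; suc; _≤_; _⊔_; s≤s)
open import Data.Nat.Properties using (m≤m⊔n; m≤n⊔m; ≤-trans)
open import Data.Product using (∃; ∃₂; _×_; _,_)
open import Data.Sum using (_⊎_; inj₁; inj₂)
open import Function using (_∘_)
open import Function.Bundles using (_⇔_; mk⇔; Equivalence)
import Function.Properties.Equivalence as ⇔
open import Relation.Binary.Construct.Closure.ReflexiveTransitive using (ε; _◅_; _◅◅_)
import Relation.Binary.Reasoning.Setoid as SetoidReasoning
open import Relation.Nullary as Dec using (Dec; contradiction)
open import Relation.Binary.PropositionalEquality as ≡ using (_≡_; _≢_)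

module _ {n : ℕ} where

  infix 4 _≈_
  _≈_ : Mon n → Mon n → Set
  t ≈ u = Eω ⊢ t ≈ u

  subst₃ : Mon n → Mon n → Mon n → Var → Mon n
  subst₃ t u w 0 = t
  subst₃ t u w 1 = u
  subst₃ t u w _ = w

  ⊕-semilattice : IdempotentCommutativeMonoid _ _
  ⊕-semilattice = record
    { Carrier = Mon n
    ; _≈_ = _≈_
    ; _∙_ = _⊕_
    ; ε = verd end
    ; isIdempotentCommutativeMonoid = record
      { isCommutativeMonoid = record
        { isMonoid = record
          { isSemigroup = record
            { isMagma = record
              { isEquivalence = record { refl = refl ; sym = sym ; trans = trans }
              ; ∙-cong = cong⊕
              }
            ; assoc = λ t u w → sym (subst (subst₃ t u w) (ax A2))
            }
          ; identity = (λ t → trans (comm (verd end) t) (identityʳ t)) , identityʳ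
          }
        ; comm = comm
        }
      ; idem = λ t → subst (subst₃ t t t) (ax A3)
      }
    }
    where
    comm : ∀ t u → t ⊕ u ≈ u ⊕ t
    comm t u = subst (subst₃ t u t) (ax A1)
    identityʳ : ∀ t → t ⊕ verd end ≈ t
    identityʳ t = subst (subst₃ t t t) (ax A4)

  open IdempotentCommutativeMonoid ⊕-semilattice
    using (setoid; assoc; comm; identityˡ; identityʳ; idem; commutativeSemigroup)
  open CommutativeSemigroupProperties commutativeSemigroup using (interchange)
  open SetoidReasoning setoid

  ∙-distrib-⊕ : ∀ a t u → a ∙ (t ⊕ u) ≈ a ∙ t ⊕ a ∙ u
  ∙-distrib-⊕ a t u = subst (subst₃ t u t) (ax (Da a))

  ⨁ : List (Mon n) → Mon n
  ⨁ = foldr _⊕_ (verd end)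

  sumL'≈⨁ : ∀ ts → sumL' ts ≈ ⨁ ts
  sumL'≈⨁ [] = refl
  sumL'≈⨁ (t ∷ []) = sym (identityʳ t)
  sumL'≈⨁ (t ∷ u ∷ ts) = cong⊕ refl (sumL'≈⨁ (u ∷ ts))

  ⨁-map-cong : ∀ l {f g : Fin n → Mon n} → (∀ a → f a ≈ g a) → ⨁ (map f l) ≈ ⨁ (map g l)
  ⨁-map-cong [] f≈g = refl
  ⨁-map-cong (a ∷ l) f≈g = cong⊕ (f≈g a) (⨁-map-cong l f≈g)

  ⨁-map-⊕ : ∀ l (f g : Fin n → Mon n) →
            ⨁ (map f l) ⊕ ⨁ (map g l) ≈ ⨁ (map (λ a → f a ⊕ g a) l)
  ⨁-map-⊕ [] f g = identityʳ _
  ⨁-map-⊕ (a ∷ l) f g = trans (interchange _ _ _ _) (cong⊕ refl (⨁-map-⊕ l f g))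

  ⨁-map-end : ∀ l → ⨁ (map (λ (_ : Fin n) → verd end) l) ≈ verd end
  ⨁-map-end [] = refl
  ⨁-map-end (a ∷ l) = trans (identityˡ _) (⨁-map-end l)

  when : {P : Set} → Dec P → Mon n → Mon n
  when (Dec.yes _) t = t
  when (Dec.no _) t = verd end

  when-⊕ : {P : Set} (p? : Dec P) (t : Mon n) → when p? t ⊕ t ≈ t
  when-⊕ (Dec.yes _) t = idem t
  when-⊕ (Dec.no _) t = identityˡ t

  only : Fin n → Mon n → Fin n → Mon n
  only b t a = when (a ≟ b) t

  ⨁-only-⊕ : ∀ l b t → ⨁ (map (only b t) l) ⊕ t ≈ t
  ⨁-only-⊕ [] b t = identityˡ t
  ⨁-only-⊕ (a ∷ l) b t = begin
    (only b t a ⊕ ⨁ (map (only b t) l)) ⊕ t ≈⟨ assoc _ _ _ ⟩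
    only b t a ⊕ (⨁ (map (only b t) l) ⊕ t) ≈⟨ cong⊕ refl (⨁-only-⊕ l b t) ⟩
    only b t a ⊕ t                          ≈⟨ when-⊕ (a ≟ b) t ⟩
    t                                       ∎

  ⨁-only : ∀ l b t → b ∈ l → ⨁ (map (only b t) l) ≈ t
  ⨁-only (b ∷ l) b t (here ≡.refl) with b ≟ b
  ... | Dec.yes _ = trans (comm _ _) (⨁-only-⊕ l b t)
  ... | Dec.no b≢b = contradiction ≡.refl b≢b
  ⨁-only (a ∷ l) b t (there b∈l) =
    trans (cong⊕ refl (⨁-only l b t b∈l)) (when-⊕ (a ≟ b) t)

  ∙-when : ∀ a b t → a ∙ when (a ≟ b) t ≈ when (a ≟ b) (b ∙ t)
  ∙-when a b t with a ≟ b
  ... | Dec.yes ≡.refl = refl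
  ... | Dec.no _ = ax (Ea a)

  deriv : Mon n → Fin n → Mon n
  deriv (verd v) a = verd v
  deriv (b ∙ m) a = when (a ≟ b) m
  deriv (m ⊕ m') a = deriv m a ⊕ deriv m' a
  deriv (var i) a = verd end

  derivs : Mon n → List (Fin n) → Mon n
  derivs m [] = m
  derivs m (a ∷ s) = derivs (deriv m a) s

  data Depth≤ : ℕ → Mon n → Set where
    d-verd : ∀ {d} v → Depth≤ d (verd v)
    d-pre  : ∀ {d} a {m} → Depth≤ d m → Depth≤ (suc d) (a ∙ m)
    d-sum  : ∀ {d m m'} → Depth≤ d m → Depth≤ d m' → Depth≤ d (m ⊕ m')

  depth : Mon n → ℕ
  depth (verd v) = 0
  depth (a ∙ m) = suc (depth m)
  depth (m ⊕ m') = depth m ⊔ depth m'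
  depth (var i) = 0

  Closed⇒Depth≤ : ∀ {m d} → Closed m → depth m ≤ d → Depth≤ d m
  Closed⇒Depth≤ (c-verd v) _ = d-verd v
  Closed⇒Depth≤ (c-pre a c) (s≤s le) = d-pre a (Closed⇒Depth≤ c le)
  Closed⇒Depth≤ (c-sum {m} {m'} c c') le =
    d-sum (Closed⇒Depth≤ c (≤-trans (m≤m⊔n (depth m) (depth m')) le))
          (Closed⇒Depth≤ c' (≤-trans (m≤n⊔m (depth m) (depth m')) le))

  Depth≤-deriv : ∀ {d m} a → Depth≤ (suc d) m → Depth≤ d (deriv m a)
  Depth≤-deriv a (d-verd v) = d-verd v
  Depth≤-deriv a (d-pre b dm) with a ≟ b
  ... | Dec.yes _ = dm
  ... | Dec.no _ = d-verd end
  Depth≤-deriv a (d-sum dm dm') = d-sum (Depth≤-deriv a dm) (Depth≤-deriv a dm')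

  expand : ∀ {d m} → Depth≤ d m → m ≈ ⨁ (map (λ a → a ∙ deriv m a) (allFin n))
  expand (d-verd yes) = trans (ax Yω) (sumL'≈⨁ (map (λ a → a ∙ verd yes) (allFin n)))
  expand (d-verd no) = trans (ax Nω) (sumL'≈⨁ (map (λ a → a ∙ verd no) (allFin n)))
  expand (d-verd end) =
    sym (trans (⨁-map-cong (allFin n) (λ a → ax (Ea a))) (⨁-map-end (allFin n)))
  expand (d-pre b {m} _) =
    sym (trans (⨁-map-cong (allFin n) (λ a → ∙-when a b m))
               (⨁-only (allFin n) b (b ∙ m) (∈-allFin b)))
  expand (d-sum {m = m} {m'} dm dm') = begin
    m ⊕ m'
      ≈⟨ cong⊕ (expand dm) (expand dm') ⟩
    ⨁ (map (λ a → a ∙ deriv m a) (allFin n)) ⊕ ⨁ (map (λ a → a ∙ deriv m' a) (allFin n))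
      ≈⟨ ⨁-map-⊕ (allFin n) (λ a → a ∙ deriv m a) (λ a → a ∙ deriv m' a) ⟩
    ⨁ (map (λ a → a ∙ deriv m a ⊕ a ∙ deriv m' a) (allFin n))
      ≈⟨ ⨁-map-cong (allFin n) (λ a → sym (∙-distrib-⊕ a (deriv m a) (deriv m' a))) ⟩
    ⨁ (map (λ a → a ∙ deriv (m ⊕ m') a) (allFin n))
      ∎

  HasVerdict : Verdict → Mon n → Set
  HasVerdict v (verd v') = v ≡ v'
  HasVerdict v (a ∙ m) = ⊥
  HasVerdict v (m ⊕ m') = HasVerdict v m ⊎ HasVerdict v m'
  HasVerdict v (var i) = ⊥

  Reaches : Verdict → Mon n → List (Fin n) → Set
  Reaches v m s = HasVerdict v (derivs m s)

  HasVerdict-deriv : ∀ {v} m a → HasVerdict v m → HasVerdict v (deriv m a)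
  HasVerdict-deriv (verd v) a h = h
  HasVerdict-deriv (m ⊕ m') a (inj₁ h) = inj₁ (HasVerdict-deriv m a h)
  HasVerdict-deriv (m ⊕ m') a (inj₂ h) = inj₂ (HasVerdict-deriv m' a h)

  HasVerdict⇒Reaches : ∀ {v} m s → HasVerdict v m → Reaches v m s
  HasVerdict⇒Reaches m [] h = h
  HasVerdict⇒Reaches m (a ∷ s) h = HasVerdict⇒Reaches (deriv m a) s (HasVerdict-deriv m a h)

  Reaches-verd : ∀ {v} v' s → Reaches v (verd v') s → v ≡ v'
  Reaches-verd v' [] r = r
  Reaches-verd v' (a ∷ s) r = Reaches-verd v' s r

  Reaches-⊕ : ∀ {v} m m' s → Reaches v (m ⊕ m') s ⇔ (Reaches v m s ⊎ Reaches v m' s)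
  Reaches-⊕ m m' [] = ⇔.refl
  Reaches-⊕ m m' (a ∷ s) = Reaches-⊕ (deriv m a) (deriv m' a) s

  deriv-flat : ∀ {m} a → Depth≤ 0 m → deriv m a ≡ m
  deriv-flat a (d-verd v) = ≡.refl
  deriv-flat a (d-sum dm dm') = ≡.cong₂ _⊕_ (deriv-flat a dm) (deriv-flat a dm')

  Reaches-flat : ∀ {v m} s → Depth≤ 0 m → Reaches v m s → HasVerdict v m
  Reaches-flat [] dm r = r
  Reaches-flat {v} (a ∷ s) dm r =
    Reaches-flat s dm (≡.subst (λ t → Reaches v t s) (deriv-flat a dm) r)

  HasVerdict⇒τ : ∀ {v} (m : Mon n) → HasVerdict v m → Step m τ (verd v)
  HasVerdict⇒τ (verd v) ≡.refl = verdS v τ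
  HasVerdict⇒τ (m ⊕ m') (inj₁ h) = sumL m' (HasVerdict⇒τ m h)
  HasVerdict⇒τ (m ⊕ m') (inj₂ h) = sumR m (HasVerdict⇒τ m' h)

  τ⇒HasVerdict : ∀ {m t} → Step m τ t → ∃ λ v → t ≡ verd v × HasVerdict v m
  τ⇒HasVerdict (sumL k st) with τ⇒HasVerdict st
  ... | v , t≡v , h = v , t≡v , inj₁ h
  τ⇒HasVerdict (sumR k st) with τ⇒HasVerdict st
  ... | v , t≡v , h = v , t≡v , inj₂ h
  τ⇒HasVerdict (verdS v _) = v , ≡.refl , ≡.refl

  step-verd : ∀ {v α} {t : Mon n} → Step (verd v) α t → t ≡ verd v
  step-verd (verdS v α) = ≡.refl

  WeakEps-verd : ∀ {v} {t : Mon n} → WeakEps (verd v) t → t ≡ verd v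
  WeakEps-verd ε = ≡.refl
  WeakEps-verd (st ◅ r) with step-verd st
  ... | ≡.refl = WeakEps-verd r

  WeakEps-inv : ∀ {m t} → WeakEps m t → t ≡ m ⊎ ∃ λ v → t ≡ verd v × HasVerdict v m
  WeakEps-inv ε = inj₁ ≡.refl
  WeakEps-inv (st ◅ r) with τ⇒HasVerdict st
  ... | v , ≡.refl , h = inj₂ (v , WeakEps-verd r , h)

  Weak-cons : ∀ {m p q : Mon n} {a t} s → WeakEps m p → Step p (act a) q → Weak q s t → Weak m (a ∷ s) t
  Weak-cons {q = q} [] e st r = _ , q , e , st , r
  Weak-cons {q = q} (b ∷ s) e st r = q , (_ , q , e , st , ε) , r

  Weak-◅◅ : ∀ {m m₁ t : Mon n} s → WeakEps m m₁ → Weak m₁ s t → Weak m s t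
  Weak-◅◅ [] e r = e ◅◅ r
  Weak-◅◅ (a ∷ []) e (p , q , e₁ , st , e₂) = p , q , e ◅◅ e₁ , st , e₂
  Weak-◅◅ (a ∷ b ∷ s) e (m₂ , (p , q , e₁ , st , e₂) , r) = m₂ , (p , q , e ◅◅ e₁ , st , e₂) , r

  Weak-uncons : ∀ {m : Mon n} {a t} s → Weak m (a ∷ s) t →
                ∃₂ λ p q → WeakEps m p × Step p (act a) q × Weak q s t
  Weak-uncons [] (p , q , e₁ , st , e₂) = p , q , e₁ , st , e₂
  Weak-uncons (b ∷ s) (m₁ , (p , q , e₁ , st , e₂) , r) = p , q , e₁ , st , Weak-◅◅ (b ∷ s) e₂ r

  Weak-mono : ∀ {m m' : Mon n} {a t} → (∀ {α u} → Step m α u → Step m' α u) →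
              ∀ s → Weak m (a ∷ s) t → Weak m' (a ∷ s) t
  Weak-mono lift s w with Weak-uncons s w
  ... | p , q , ε , st , r = Weak-cons s ε (lift st) r
  ... | p , q , st₁ ◅ e , st , r = Weak-cons s (lift st₁ ◅ e) st r

  Weak-verd : ∀ v s → Weak {n} (verd v) s (verd v)
  Weak-verd v [] = ε
  Weak-verd v (a ∷ s) = Weak-cons s ε (verdS v (act a)) (Weak-verd v s)

  step⇒Reaches : ∀ {v m a q} s → Step m (act a) q → Reaches v q s → Reaches v (deriv m a) s
  step⇒Reaches s (pre a m) r with a ≟ a
  ... | Dec.yes _ = r
  ... | Dec.no a≢a = contradiction ≡.refl a≢a
  step⇒Reaches {a = a} s (sumL {m} k st) r =
    Equivalence.from (Reaches-⊕ (deriv m a) (deriv k a) s) (inj₁ (step⇒Reaches s st r))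
  step⇒Reaches {a = a} s (sumR {m} k st) r =
    Equivalence.from (Reaches-⊕ (deriv k a) (deriv m a) s) (inj₂ (step⇒Reaches s st r))
  step⇒Reaches s (verdS v _) r = r

  WeakEps-step⇒Reaches : ∀ {v m p a q} s → WeakEps m p → Step p (act a) q →
                       Reaches v q s → Reaches v (deriv m a) s
  WeakEps-step⇒Reaches s e st r with WeakEps-inv e
  ... | inj₁ ≡.refl = step⇒Reaches s st r
  ... | inj₂ (v' , ≡.refl , h) with step-verd st
  ...   | ≡.refl rewrite Reaches-verd v' s r = HasVerdict⇒Reaches _ s (HasVerdict-deriv _ _ h)

  Weak⇒Reaches : ∀ {v} m s → Weak m s (verd v) → Reaches v m s
  Weak⇒Reaches m [] e with WeakEps-inv e
  ... | inj₁ ≡.refl = ≡.refl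
  ... | inj₂ (v , ≡.refl , h) = h
  Weak⇒Reaches m (a ∷ s) w with Weak-uncons s w
  ... | p , q , e , st , r = WeakEps-step⇒Reaches s e st (Weak⇒Reaches q s r)

  -- Fails for end: deriv produces end at mismatched prefixes, where no transition exists.
  Reaches⇒Weak : ∀ {v} → v ≢ end → ∀ m s → Reaches v m s → Weak m s (verd v)
  Reaches⇒Weak v≢end m [] r = HasVerdict⇒τ m r ◅ ε
  Reaches⇒Weak v≢end (verd v') (a ∷ s) r rewrite Reaches-verd v' (a ∷ s) r = Weak-verd v' (a ∷ s)
  Reaches⇒Weak v≢end (b ∙ m) (a ∷ s) r with a ≟ b
  ... | Dec.yes ≡.refl = Weak-cons s ε (pre a m) (Reaches⇒Weak v≢end m s r)
  ... | Dec.no _ = contradiction (Reaches-verd end s r) v≢end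
  Reaches⇒Weak v≢end (m ⊕ m') (a ∷ s) r with Equivalence.to (Reaches-⊕ m m' (a ∷ s)) r
  ... | inj₁ r₁ = Weak-mono (sumL m') s (Reaches⇒Weak v≢end m (a ∷ s) r₁)
  ... | inj₂ r₂ = Weak-mono (sumR m) s (Reaches⇒Weak v≢end m' (a ∷ s) r₂)
  Reaches⇒Weak v≢end (var i) (a ∷ s) r = contradiction (Reaches-verd end s r) v≢end

  Weak⇔Reaches : ∀ {v} → v ≢ end → ∀ m s → Weak m s (verd v) ⇔ Reaches v m s
  Weak⇔Reaches v≢end m s = mk⇔ (Weak⇒Reaches m s) (Reaches⇒Weak v≢end m s)

  Ext-cong : ∀ {L L' : List (Fin n) → Set} → (∀ s → L s ⇔ L' s) → ∀ w → Ext L w ⇔ Ext L' w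
  Ext-cong L⇔L' w = mk⇔ (λ (s , l , s⊑w) → s , Equivalence.to (L⇔L' s) l , s⊑w)
                        (λ (s , l , s⊑w) → s , Equivalence.from (L⇔L' s) l , s⊑w)

  _∷ˢ_ : Fin n → Stream n → Stream n
  (a ∷ˢ w) 0 = a
  (a ∷ˢ w) (suc i) = w i

  Ext-deriv : ∀ {v} m a w → Ext (Reaches v (deriv m a)) w ⇔ Ext (Reaches v m) (a ∷ˢ w)
  Ext-deriv m a w = mk⇔ (λ (s , r , s⊑w) → a ∷ s , r , p-cons s⊑w) from
    where
    from : Ext (Reaches _ m) (a ∷ˢ w) → Ext (Reaches _ (deriv m a)) w
    from ([] , h , p-nil _) = [] , HasVerdict-deriv m a h , p-nil w
    from (_ ∷ s , r , p-cons s⊑w) = s , r , s⊑w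

  infix 4 _≋_
  _≋_ : Mon n → Mon n → Set
  m ≋ m' = ∀ v → v ≢ end → ∀ w → Ext (Reaches v m) w ⇔ Ext (Reaches v m') w

  ≃ω⇒≋ : ∀ {m m'} → m ≃ω m' → m ≋ m'
  ≃ω⇒≋ {m} {m'} (La≈ , Lr≈) = λ
    { yes _ → transfer (λ ()) La≈
    ; no _ → transfer (λ ()) Lr≈
    ; end end≢end → contradiction ≡.refl end≢end
    }
    where
    transfer : ∀ {v} → v ≢ end →
               (∀ w → Ext (λ s → Weak m s (verd v)) w ⇔ Ext (λ s → Weak m' s (verd v)) w) →
               ∀ w → Ext (Reaches v m) w ⇔ Ext (Reaches v m') w
    transfer v≢end L≈ w =
      ⇔.trans (⇔.sym (Ext-cong (Weak⇔Reaches v≢end m) w))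
              (⇔.trans (L≈ w) (Ext-cong (Weak⇔Reaches v≢end m') w))

  ≋-deriv : ∀ {m m'} a → m ≋ m' → deriv m a ≋ deriv m' a
  ≋-deriv {m} {m'} a m≋m' v v≢end w =
    ⇔.trans (Ext-deriv m a w) (⇔.trans (m≋m' v v≢end (a ∷ˢ w)) (⇔.sym (Ext-deriv m' a w)))

  Ext-flat : ∀ {v m} → Depth≤ 0 m → ∀ w → Ext (Reaches v m) w ⇔ HasVerdict v m
  Ext-flat dm w = mk⇔ (λ (s , r , _) → Reaches-flat s dm r) (λ h → [] , h , p-nil w)

  HasVerdict⇒absorbs : ∀ {v} t → HasVerdict v t → t ⊕ verd v ≈ t
  HasVerdict⇒absorbs (verd v) ≡.refl = idem (verd v)
  HasVerdict⇒absorbs {v} (t ⊕ t') (inj₁ h) = begin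
    (t ⊕ t') ⊕ verd v ≈⟨ assoc t t' (verd v) ⟩
    t ⊕ (t' ⊕ verd v) ≈⟨ cong⊕ refl (comm t' (verd v)) ⟩
    t ⊕ (verd v ⊕ t') ≈⟨ sym (assoc t (verd v) t') ⟩
    (t ⊕ verd v) ⊕ t' ≈⟨ cong⊕ (HasVerdict⇒absorbs t h) refl ⟩
    t ⊕ t'            ∎
  HasVerdict⇒absorbs {v} (t ⊕ t') (inj₂ h) =
    trans (assoc t t' (verd v)) (cong⊕ refl (HasVerdict⇒absorbs t' h))

  flat-absorbs : ∀ {t u} → Depth≤ 0 u →
                 (∀ v → v ≢ end → HasVerdict v u → HasVerdict v t) → t ⊕ u ≈ t
  flat-absorbs (d-verd end) _ = identityʳ _
  flat-absorbs (d-verd yes) u⊆t = HasVerdict⇒absorbs _ (u⊆t yes (λ ()) ≡.refl)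
  flat-absorbs (d-verd no) u⊆t = HasVerdict⇒absorbs _ (u⊆t no (λ ()) ≡.refl)
  flat-absorbs {t} (d-sum du du') u⊆t =
    trans (sym (assoc t _ _))
          (trans (cong⊕ (flat-absorbs du (λ v v≢end → u⊆t v v≢end ∘ inj₁)) refl)
                 (flat-absorbs du' (λ v v≢end → u⊆t v v≢end ∘ inj₂)))

  flat-complete : ∀ {m m'} → Depth≤ 0 m → Depth≤ 0 m' →
                  (∀ v → v ≢ end → HasVerdict v m ⇔ HasVerdict v m') → m ≈ m'
  flat-complete {m} {m'} dm dm' m⇔m' = begin
    m      ≈⟨ sym (flat-absorbs dm' (λ v v≢end → Equivalence.from (m⇔m' v v≢end))) ⟩
    m ⊕ m' ≈⟨ comm m m' ⟩
    m' ⊕ m ≈⟨ flat-absorbs dm (λ v v≢end → Equivalence.to (m⇔m' v v≢end)) ⟩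
    m'     ∎

Depth≤-complete : ∀ {n} d {m m' : Mon n} → Depth≤ d m → Depth≤ d m' → m ≋ m' → Eω ⊢ m ≈ m'
-- With Act empty no stream exists, but both expansions are the empty sum end.
Depth≤-complete {0} d dm dm' _ = trans (expand dm) (sym (expand dm'))
Depth≤-complete {suc _} 0 dm dm' m≋m' = flat-complete dm dm' λ v v≢end →
  ⇔.trans (⇔.sym (Ext-flat dm w)) (⇔.trans (m≋m' v v≢end w) (Ext-flat dm' w))
  where
  w : Stream _
  w _ = zero
Depth≤-complete {n} (suc d) {m} {m'} dm dm' m≋m' =
  trans (expand dm) (trans (⨁-map-cong (allFin n) derivatives-equal) (sym (expand dm')))
  where
  derivatives-equal : ∀ a → Eω ⊢ (a ∙ deriv m a) ≈ (a ∙ deriv m' a)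
  derivatives-equal a =
    cong∙ a (Depth≤-complete d (Depth≤-deriv a dm) (Depth≤-deriv a dm') (≋-deriv a m≋m'))

theorem3 : (n : ℕ) (m m' : Mon n) → Closed m → Closed m' → m ≃ω m' → Eω ⊢ m ≈ m'
theorem3 n m m' c c' m≃m' =
  Depth≤-complete (depth m ⊔ depth m')
    (Closed⇒Depth≤ c (m≤m⊔n (depth m) (depth m')))
    (Closed⇒Depth≤ c' (m≤n⊔m (depth m) (depth m')))
    (≃ω⇒≋ m≃m')
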